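{- Let $r\ge 1$ and $n\ge r$ be integers, and let $G$ be the graph obtained from the complete bipartite graph $K_{n,n}$ by adding, inside one of its two classes, the edges of a path on $r$ vertices. Then $G$ contains as a subgraph the square $P^2_m$ of a path on $m=\lfloor 3r/2\rfloor+1$ vertices.
   Context: All graphs are finite, simple and undirected. $P^2_m$ is the graph on vertices $v_1,\dots,v_m$ in which $v_i,v_j$ are adjacent iff $1\le |i-j|\le 2$. -}

module Defs where

open import Data.Nat using (ℕ; suc; _<_; _≤_; _*_; _+_; ∣_-_∣; ⌊_/2⌋)
open import Data.Fin using (Fin; toℕ)
open import Data.Sum using (_⊎_; inj₁; inj₂)
open import Data.Product using (_×_; Σ)
open import Data.Empty using (⊥)
open import Data.Unit using (⊤)
open import Relation.Binary.PropositionalEquality using (_≡_)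
open import Function.Definitions using (Injective)

record Graph : Set₁ where
  field
    V   : Set
    Adj : V → V → Set

open Graph public

P²-Adj : (m : ℕ) → Fin m → Fin m → Set
P²-Adj m i j = (1 ≤ ∣ toℕ i - toℕ j ∣) × (∣ toℕ i - toℕ j ∣ ≤ 2)

P² : ℕ → Graph
P² m = record { V = Fin m ; Adj = P²-Adj m }

-- K_{n,n} plus the edges of a path on r vertices inside the first class.
-- The path inside the first class is on vertices 0,1,...,r-1 (in this order).
KnnPath-Adj : (n r : ℕ) → Fin n ⊎ Fin n → Fin n ⊎ Fin n → Set
KnnPath-Adj n r (inj₁ a) (inj₁ b) =
  (toℕ a < r) × (toℕ b < r) × (∣ toℕ a - toℕ b ∣ ≡ 1)
KnnPath-Adj n r (inj₁ a) (inj₂ b) = ⊤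
KnnPath-Adj n r (inj₂ a) (inj₁ b) = ⊤
KnnPath-Adj n r (inj₂ a) (inj₂ b) = ⊥

KnnPath : ℕ → ℕ → Graph
KnnPath n r = record { V = Fin n ⊎ Fin n ; Adj = KnnPath-Adj n r }

_⊆G_ : Graph → Graph → Set
H ⊆G G = Σ (V H → V G) λ f →
  Injective _≡_ _≡_ f × (∀ x y → Adj H x y → Adj G (f x) (f y))

module Submission where

-- Let H∞ be the infinite analogue of KnnPath: vertex set ℕ ⊎ ℕ,
-- the first class carrying the path 0 - 1 - 2 - ⋯, and every vertex of the
-- first class joined to every vertex of the second.  List its vertices in the
-- "zigzag" order
--     b₀, a₀, a₁, b₁, a₂, a₃, b₂, a₄, a₅, …
-- (one second-class vertex followed by two consecutive path vertices).  Any
-- two entries at distance 1 or 2 in this list are adjacent, so the zigzag is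
-- an injective, adjacency-preserving map from the square of the infinite path.
-- Its first m = ⌊3r/2⌋ + 1 entries use path vertices below r and second-class
-- vertices below r ≤ n, so they lie in the finite graph KnnPath n r.

open import Defs
open import Data.Nat using (ℕ; zero; suc; _+_; _*_; _≤_; _<_; z≤n; s≤s; ∣_-_∣; ⌊_/2⌋; ⌈_/2⌉)
open import Data.Nat.Properties
open import Data.Nat.Tactic.RingSolver using (solve-∀)
open import Data.Fin using (Fin; toℕ; fromℕ<)
open import Data.Fin.Properties using (toℕ-fromℕ<; toℕ-injective; toℕ<n)
open import Data.Sum using (_⊎_; inj₁; inj₂; map)
open import Data.Product using (_,_)
open import Data.Empty using (⊥)
open import Data.Unit using (⊤; tt)
open import Function using (_∘_)
open import Function.Definitions using (Injective)
open import Relation.Binary.PropositionalEquality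

HostAdj : ℕ ⊎ ℕ → ℕ ⊎ ℕ → Set
HostAdj (inj₁ a) (inj₁ b) = ∣ a - b ∣ ≡ 1
HostAdj (inj₁ a) (inj₂ b) = ⊤
HostAdj (inj₂ a) (inj₁ b) = ⊤
HostAdj (inj₂ a) (inj₂ b) = ⊥

HostAdj-sym : ∀ u v → HostAdj u v → HostAdj v u
HostAdj-sym (inj₁ a) (inj₁ b) d≡1 = trans (∣-∣-comm b a) d≡1
HostAdj-sym (inj₁ a) (inj₂ b) _   = tt
HostAdj-sym (inj₂ a) (inj₁ b) _   = tt

-- Advancing one block of the zigzag: path vertices move by 2, second-class
-- vertices by 1.  It preserves adjacency of H∞.
shift : ℕ ⊎ ℕ → ℕ ⊎ ℕ
shift (inj₁ a) = inj₁ (suc (suc a))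
shift (inj₂ b) = inj₂ (suc b)

HostAdj-shift : ∀ u v → HostAdj u v → HostAdj (shift u) (shift v)
HostAdj-shift (inj₁ a) (inj₁ b) d≡1 = d≡1
HostAdj-shift (inj₁ a) (inj₂ b) _   = tt
HostAdj-shift (inj₂ a) (inj₁ b) _   = tt

-- The zigzag order: entry 3k is b_k, entries 3k+1, 3k+2 are a_{2k}, a_{2k+1}.
zigzag : ℕ → ℕ ⊎ ℕ
zigzag 0                   = inj₂ 0
zigzag 1                   = inj₁ 0
zigzag 2                   = inj₁ 1
zigzag (suc (suc (suc i))) = shift (zigzag i)

zigzag-adj₁ : ∀ i → HostAdj (zigzag i) (zigzag (1 + i))
zigzag-adj₁ 0                   = tt
zigzag-adj₁ 1                   = refl
zigzag-adj₁ 2                   = tt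
zigzag-adj₁ (suc (suc (suc i))) = HostAdj-shift (zigzag i) _ (zigzag-adj₁ i)

zigzag-adj₂ : ∀ i → HostAdj (zigzag i) (zigzag (2 + i))
zigzag-adj₂ 0                   = tt
zigzag-adj₂ 1                   = tt
zigzag-adj₂ 2                   = refl
zigzag-adj₂ (suc (suc (suc i))) = HostAdj-shift (zigzag i) _ (zigzag-adj₂ i)

distance-one-or-two : ∀ i j → 1 ≤ ∣ i - j ∣ → ∣ i - j ∣ ≤ 2 →
  (j ≡ 1 + i ⊎ j ≡ 2 + i) ⊎ (i ≡ 1 + j ⊎ i ≡ 2 + j)
distance-one-or-two 0 1 _ _                         = inj₁ (inj₁ refl)
distance-one-or-two 0 2 _ _                         = inj₁ (inj₂ refl)
distance-one-or-two 0 (suc (suc (suc j))) _ (s≤s (s≤s ()))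
distance-one-or-two 1 0 _ _                         = inj₂ (inj₁ refl)
distance-one-or-two 2 0 _ _                         = inj₂ (inj₂ refl)
distance-one-or-two (suc (suc (suc i))) 0 _ (s≤s (s≤s ()))
distance-one-or-two (suc i) (suc j) 1≤d d≤2 with distance-one-or-two i j 1≤d d≤2
... | inj₁ (inj₁ e) = inj₁ (inj₁ (cong suc e))
... | inj₁ (inj₂ e) = inj₁ (inj₂ (cong suc e))
... | inj₂ (inj₁ e) = inj₂ (inj₁ (cong suc e))
... | inj₂ (inj₂ e) = inj₂ (inj₂ (cong suc e))

zigzag-square-adj : ∀ i j → 1 ≤ ∣ i - j ∣ → ∣ i - j ∣ ≤ 2 →
  HostAdj (zigzag i) (zigzag j)
zigzag-square-adj i j 1≤d d≤2 with distance-one-or-two i j 1≤d d≤2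
... | inj₁ (inj₁ refl) = zigzag-adj₁ i
... | inj₁ (inj₂ refl) = zigzag-adj₂ i
... | inj₂ (inj₁ refl) = HostAdj-sym (zigzag j) _ (zigzag-adj₁ j)
... | inj₂ (inj₂ refl) = HostAdj-sym (zigzag j) _ (zigzag-adj₂ j)

position : ℕ ⊎ ℕ → ℕ
position (inj₁ 0)             = 1
position (inj₁ 1)             = 2
position (inj₁ (suc (suc a))) = 3 + position (inj₁ a)
position (inj₂ 0)             = 0
position (inj₂ (suc b))       = 3 + position (inj₂ b)

position-shift : ∀ u → position (shift u) ≡ 3 + position u
position-shift (inj₁ a) = refl
position-shift (inj₂ b) = refl

position-zigzag : ∀ i → position (zigzag i) ≡ i
position-zigzag 0                   = refl
position-zigzag 1                   = refl
position-zigzag 2                   = refl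
position-zigzag (suc (suc (suc i))) =
  trans (position-shift (zigzag i)) (cong (3 +_) (position-zigzag i))

zigzag-injective : Injective _≡_ _≡_ zigzag
zigzag-injective {i} {j} e = begin
  i                    ≡⟨ sym (position-zigzag i) ⟩
  position (zigzag i)  ≡⟨ cong position e ⟩
  position (zigzag j)  ≡⟨ position-zigzag j ⟩
  j                    ∎
  where open ≡-Reasoning

-- How far the zigzag has advanced after i steps: a path vertex a at position
-- i satisfies 3a + 1 ≤ 2i, a second-class vertex b sits at position 3b.
Advance : ℕ ⊎ ℕ → ℕ → Set
Advance (inj₁ a) i = 3 * a + 1 ≤ 2 * i
Advance (inj₂ b) i = 3 * b ≡ i

Advance-shift : ∀ u i → Advance u i → Advance (shift u) (3 + i)
Advance-shift (inj₁ a) i bound = subst₂ _≤_ (path-step a) (twice-step i) (+-monoʳ-≤ 6 bound)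
  where
  path-step : ∀ a → 6 + (3 * a + 1) ≡ 3 * (2 + a) + 1
  path-step = solve-∀
  twice-step : ∀ i → 6 + 2 * i ≡ 2 * (3 + i)
  twice-step = solve-∀
Advance-shift (inj₂ b) i at-3b = trans (second-step b) (cong (3 +_) at-3b)
  where
  second-step : ∀ b → 3 * (1 + b) ≡ 3 + 3 * b
  second-step = solve-∀

zigzag-advance : ∀ i → Advance (zigzag i) i
zigzag-advance 0                   = refl
zigzag-advance 1                   = s≤s z≤n
zigzag-advance 2                   = s≤s (s≤s (s≤s (s≤s z≤n)))
zigzag-advance (suc (suc (suc i))) = Advance-shift (zigzag i) i (zigzag-advance i)

InRange : ℕ → ℕ → ℕ ⊎ ℕ → Set
InRange n r (inj₁ a) = a < r
InRange n r (inj₂ b) = b < n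

half-below : ∀ b r → 1 ≤ r → b + b ≤ r → b < r
half-below zero    r 1≤r _      = 1≤r
half-below (suc b) r _   2b≤r = <-≤-trans (m<m+n (suc b) (s≤s z≤n)) 2b≤r

advance-in-range : ∀ {n r} u i → 1 ≤ r → r ≤ n → 2 * i ≤ 3 * r →
  Advance u i → InRange n r u
advance-in-range (inj₁ a) i _ _ 2i≤3r bound =
  *-cancelˡ-< 3 a _ (≤-trans (≤-reflexive (+-comm 1 (3 * a))) (≤-trans bound 2i≤3r))
advance-in-range {n} {r} (inj₂ b) i 1≤r r≤n 2i≤3r at-3b =
  ≤-trans (half-below b r 1≤r (*-cancelˡ-≤ 3 6b≤3r)) r≤n
  where
  6b≤3r : 3 * (b + b) ≤ 3 * r
  6b≤3r = begin
    3 * (b + b)   ≡⟨ regroup b ⟩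
    2 * (3 * b)   ≡⟨ cong (2 *_) at-3b ⟩
    2 * i         ≤⟨ 2i≤3r ⟩
    3 * r         ∎
    where
    open ≤-Reasoning
    regroup : ∀ b → 3 * (b + b) ≡ 2 * (3 * b)
    regroup = solve-∀

double-floor-half : ∀ x → 2 * ⌊ x /2⌋ ≤ x
double-floor-half x = begin
  2 * ⌊ x /2⌋            ≡⟨ cong (⌊ x /2⌋ +_) (+-identityʳ ⌊ x /2⌋) ⟩
  ⌊ x /2⌋ + ⌊ x /2⌋      ≤⟨ +-monoʳ-≤ ⌊ x /2⌋ (⌊n/2⌋≤⌈n/2⌉ x) ⟩
  ⌊ x /2⌋ + ⌈ x /2⌉      ≡⟨ ⌊n/2⌋+⌈n/2⌉≡n x ⟩
  x                      ∎
  where open ≤-Reasoning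

zigzag-in-range : ∀ {n r} i → 1 ≤ r → r ≤ n → i < ⌊ (3 * r) /2⌋ + 1 →
  InRange n r (zigzag i)
zigzag-in-range {r = r} i 1≤r r≤n i<m =
  advance-in-range (zigzag i) i 1≤r r≤n 2i≤3r (zigzag-advance i)
  where
  2i≤3r : 2 * i ≤ 3 * r
  2i≤3r = ≤-trans (*-monoʳ-≤ 2 (m<1+n⇒m≤n (subst (i <_) (+-comm _ 1) i<m))) (double-floor-half (3 * r))

toKnn : ∀ {n r} → r ≤ n → (u : ℕ ⊎ ℕ) → InRange n r u → Fin n ⊎ Fin n
toKnn r≤n (inj₁ a) a<r = inj₁ (fromℕ< (≤-trans a<r r≤n))
toKnn r≤n (inj₂ b) b<n = inj₂ (fromℕ< b<n)

forget : ∀ {n} → Fin n ⊎ Fin n → ℕ ⊎ ℕ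
forget = map toℕ toℕ

forget-toKnn : ∀ {n r} (r≤n : r ≤ n) u (u-in : InRange n r u) →
  forget (toKnn r≤n u u-in) ≡ u
forget-toKnn r≤n (inj₁ a) a<r = cong inj₁ (toℕ-fromℕ< (≤-trans a<r r≤n))
forget-toKnn r≤n (inj₂ b) b<n = cong inj₂ (toℕ-fromℕ< b<n)

toKnn-adj : ∀ {n r} (r≤n : r ≤ n) u v (u-in : InRange n r u) (v-in : InRange n r v) →
  HostAdj u v → KnnPath-Adj n r (toKnn r≤n u u-in) (toKnn r≤n v v-in)
toKnn-adj r≤n (inj₁ a) (inj₁ b) a<r b<r d≡1
  rewrite toℕ-fromℕ< (≤-trans a<r r≤n) | toℕ-fromℕ< (≤-trans b<r r≤n) = a<r , b<r , d≡1
toKnn-adj r≤n (inj₁ a) (inj₂ b) _ _ _ = tt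
toKnn-adj r≤n (inj₂ a) (inj₁ b) _ _ _ = tt

restrict : ∀ {n r} (H : Graph) (f : V H → ℕ ⊎ ℕ) → r ≤ n →
  Injective _≡_ _≡_ f → (∀ x y → Adj H x y → HostAdj (f x) (f y)) →
  (∀ x → InRange n r (f x)) → H ⊆G KnnPath n r
restrict H f r≤n f-inj f-adj f-in = embed , embed-injective , embed-adj
  where
  embed : V H → _
  embed x = toKnn r≤n (f x) (f-in x)
  embed-injective : Injective _≡_ _≡_ embed
  embed-injective {x} {y} e = f-inj (begin
    f x                  ≡⟨ sym (forget-toKnn r≤n (f x) (f-in x)) ⟩
    forget (embed x)     ≡⟨ cong forget e ⟩
    forget (embed y)     ≡⟨ forget-toKnn r≤n (f y) (f-in y) ⟩
    f y                  ∎)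
    where open ≡-Reasoning
  embed-adj : ∀ x y → Adj H x y → Adj (KnnPath _ _) (embed x) (embed y)
  embed-adj x y xy = toKnn-adj r≤n (f x) (f y) (f-in x) (f-in y) (f-adj x y xy)

lemma12 : (r n : ℕ) → 1 ≤ r → r ≤ n →
    P² (⌊ (3 * r) /2⌋ + 1) ⊆G KnnPath n r
lemma12 r n 1≤r r≤n =
  restrict (P² (⌊ (3 * r) /2⌋ + 1)) (zigzag ∘ toℕ) r≤n
    (toℕ-injective ∘ zigzag-injective)
    (λ i j (1≤d , d≤2) → zigzag-square-adj (toℕ i) (toℕ j) 1≤d d≤2)
    (λ i → zigzag-in-range (toℕ i) 1≤r r≤n (toℕ<n i))
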